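{- Let $\mathbf G$ be a finite abelian group and $A,B\subseteq\mathbf G$ be non-empty sets. Then $\mathrm{un}(A+B)\geqslant\mathrm{un}(A)\,\mathrm{un}(B)$.
   Context: A set $U\subseteq\mathbf G$ is $k$-universal if for any $z_1,\dots,z_k\in\mathbf G$ there exists $w\in\mathbf G$ with $z_1+w,\dots,z_k+w\in U$. $\mathrm{un}(U)$ is the largest $k\geqslant1$ such that $U$ is $k$-universal, with $\mathrm{un}(U)=1$ if there is no such $k$, and $\mathrm{un}(\mathbf G)=\infty$. -}

module Defs where

open import Level using (Level; _⊔_)
open import Data.Nat using (ℕ; _≤_; _*_)
open import Data.Fin using (Fin)
open import Data.Product using (Σ; ∃; _×_)
open import Data.Sum using (_⊎_)
open import Data.Empty using (⊥)
open import Relation.Nullary using (¬_)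
open import Relation.Binary.PropositionalEquality using (_≡_)
open import Algebra.Bundles using (AbelianGroup)

data ℕ∞ : Set where
  fin : ℕ → ℕ∞
  ∞   : ℕ∞

data _≤∞_ : ℕ∞ → ℕ∞ → Set where
  fin≤fin : ∀ {m n} → m ≤ n → fin m ≤∞ fin n
  _≤∞∞    : ∀ x → x ≤∞ ∞

-- multiplication on ℕ∞ (only used on values ≥ 1, where ∞ · x = ∞)
_*∞_ : ℕ∞ → ℕ∞ → ℕ∞
fin m *∞ fin n = fin (m * n)
fin _ *∞ ∞     = ∞
∞     *∞ _     = ∞

module _ {c ℓ : Level} (G : AbelianGroup c ℓ) where
  open AbelianGroup G renaming (Carrier to 𝔾)

  IsFinite : Set (c ⊔ ℓ)
  IsFinite = Σ ℕ λ n → Σ (Fin n → 𝔾) λ f → ∀ g → ∃ λ i → f i ≈ g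

  RespectsEq : ∀ {p} → (𝔾 → Set p) → Set (c ⊔ ℓ ⊔ p)
  RespectsEq U = ∀ {x y} → x ≈ y → U x → U y

  NonEmpty : ∀ {p} → (𝔾 → Set p) → Set (c ⊔ p)
  NonEmpty U = ∃ λ x → U x

  IsWhole : ∀ {p} → (𝔾 → Set p) → Set (c ⊔ p)
  IsWhole U = ∀ g → U g

  Sumset : ∀ {p} → (𝔾 → Set p) → (𝔾 → Set p) → 𝔾 → Set (c ⊔ ℓ ⊔ p)
  Sumset A B x = ∃ λ a → ∃ λ b → A a × B b × x ≈ a ∙ b

  Universal : ∀ {p} → (𝔾 → Set p) → ℕ → Set (c ⊔ p)
  Universal U k = (z : Fin k → 𝔾) → ∃ λ w → ∀ i → U (z i ∙ w)

  data IsUn {p} (U : 𝔾 → Set p) : ℕ∞ → Set (c ⊔ p) where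
    un-whole   : IsWhole U → IsUn U ∞
    un-largest : ∀ {k} → ¬ IsWhole U → 1 ≤ k → Universal U k
               → (∀ j → 1 ≤ j → Universal U j → j ≤ k) → IsUn U (fin k)
    un-none    : ¬ IsWhole U → (∀ j → 1 ≤ j → ¬ Universal U j) → IsUn U (fin 1)

{-# OPTIONS --safe #-}
-- Index un(A) un(B) points as z i j. Translate each row z i into B by some w i, then the
-- points - w i into A by a single v: z i j + v = (v - w i) + (z i j + w i) lies in A + B.
-- So A + B is un(A) un(B)-universal. If un(A + B) is finite, neither A nor B is the whole
-- group (else A + B would be), and the finite values of un are attained, so maximality
-- of un(A + B) concludes.
module Submission where

open import Defs
open import Level using (Level; _⊔_)
open import Algebra.Bundles using (AbelianGroup)
import Algebra.Properties.Group as GroupProperties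
open import Data.Nat using (ℕ; _≤_; _*_; s≤s; z≤n)
open import Data.Nat.Properties using (*-mono-≤)
open import Data.Fin using (zero; combine; remQuot)
open import Data.Fin.Properties using (combine-remQuot)
open import Data.Product using (∃; _×_; _,_; proj₁; proj₂; uncurry)
open import Data.Empty using (⊥-elim)
open import Relation.Nullary using (¬_)
open import Relation.Binary.PropositionalEquality using (_≡_; subst)

module _ {c ℓ : Level} (G : AbelianGroup c ℓ) where
  open AbelianGroup G renaming (Carrier to 𝔾)
  open GroupProperties group using (\\-leftDividesˡ; //-rightDividesˡ)
  open import Relation.Binary.Reasoning.Setoid setoid

  IndexedUniversal : ∀ {i p} → Set i → (𝔾 → Set p) → Set (c ⊔ i ⊔ p)
  IndexedUniversal I U = (z : I → 𝔾) → ∃ λ w → ∀ i → U (z i ∙ w)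

  IndexedUniversal-surjective : ∀ {i j p} {I : Set i} {J : Set j} {U : 𝔾 → Set p}
    (f : I → J) → (∀ y → ∃ λ x → f x ≡ y)
    → IndexedUniversal I U → IndexedUniversal J U
  IndexedUniversal-surjective {U = U} f surj univ z with univ (λ x → z (f x))
  ... | w , zf∙w∈U = w , λ y → let (x , fx≡y) = surj y in
                              subst (λ t → U (z t ∙ w)) fx≡y (zf∙w∈U x)

  IndexedUniversal-Sumset : ∀ {i j p} {I : Set i} {J : Set j} {A B : 𝔾 → Set p}
    → IndexedUniversal I A → IndexedUniversal J B
    → IndexedUniversal (I × J) (Sumset G A B)
  IndexedUniversal-Sumset {I = I} {A = A} {B} univA univB z = v , λ (x , y) →
    (w x ⁻¹ ∙ v) , (z (x , y) ∙ w x) , A-part x , B-part x y , split (z (x , y)) (w x)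
    where
    row : (x : I) → ∃ λ w → ∀ y → B (z (x , y) ∙ w)
    row x = univB (λ y → z (x , y))
    w : I → 𝔾
    w x = proj₁ (row x)
    B-part : ∀ x y → B (z (x , y) ∙ w x)
    B-part x = proj₂ (row x)
    column : ∃ λ v → ∀ x → A (w x ⁻¹ ∙ v)
    column = univA (λ x → w x ⁻¹)
    v : 𝔾
    v = proj₁ column
    A-part : ∀ x → A (w x ⁻¹ ∙ v)
    A-part = proj₂ column
    split : ∀ t u → t ∙ v ≈ (u ⁻¹ ∙ v) ∙ (t ∙ u)
    split t u = begin
      t ∙ v                 ≈⟨ ∙-congˡ (\\-leftDividesˡ u v) ⟨
      t ∙ (u ∙ (u ⁻¹ ∙ v))  ≈⟨ assoc t u (u ⁻¹ ∙ v) ⟨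
      (t ∙ u) ∙ (u ⁻¹ ∙ v)  ≈⟨ comm (t ∙ u) (u ⁻¹ ∙ v) ⟩
      (u ⁻¹ ∙ v) ∙ (t ∙ u)  ∎

  Universal-* : ∀ {p} {A B : 𝔾 → Set p} {m n : ℕ}
    → Universal G A m → Universal G B n → Universal G (Sumset G A B) (m * n)
  Universal-* {A = A} {B} {m} {n} univA univB =
    IndexedUniversal-surjective {U = Sumset G A B} (uncurry combine)
      (λ k → remQuot n k , combine-remQuot {m} n k)
      (IndexedUniversal-Sumset {A = A} {B} univA univB)

  NonEmpty⇒Universal₁ : ∀ {p} {U : 𝔾 → Set p}
    → RespectsEq G U → NonEmpty G U → Universal G U 1
  NonEmpty⇒Universal₁ resp (x , x∈U) z =
    z zero ⁻¹ ∙ x , λ { zero → resp (sym (\\-leftDividesˡ (z zero) x)) x∈U }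

  Sumset-wholeˡ : ∀ {p} {A B : 𝔾 → Set p}
    → IsWhole G A → NonEmpty G B → IsWhole G (Sumset G A B)
  Sumset-wholeˡ wholeA (b , b∈B) g =
    g ∙ b ⁻¹ , b , wholeA (g ∙ b ⁻¹) , b∈B , sym (//-rightDividesˡ b g)

  Sumset-wholeʳ : ∀ {p} {A B : 𝔾 → Set p}
    → NonEmpty G A → IsWhole G B → IsWhole G (Sumset G A B)
  Sumset-wholeʳ (a , a∈A) wholeB g =
    a , a ⁻¹ ∙ g , a∈A , wholeB (a ⁻¹ ∙ g) , sym (\\-leftDividesˡ a g)

  module _ {p} {U : 𝔾 → Set p} where

    IsUn-fin⇒¬whole : ∀ {k} → IsUn G U (fin k) → ¬ IsWhole G U
    IsUn-fin⇒¬whole (un-largest ¬whole _ _ _) = ¬whole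
    IsUn-fin⇒¬whole (un-none ¬whole _)        = ¬whole

    IsUn-fin⇒positive : ∀ {k} → IsUn G U (fin k) → 1 ≤ k
    IsUn-fin⇒positive (un-largest _ 1≤k _ _) = 1≤k
    IsUn-fin⇒positive (un-none _ _)          = s≤s z≤n

    IsUn-fin⇒maximal : ∀ {k} → IsUn G U (fin k) → ∀ j → 1 ≤ j → Universal G U j → j ≤ k
    IsUn-fin⇒maximal (un-largest _ _ _ maximal) = maximal
    IsUn-fin⇒maximal (un-none _ none) j 1≤j univ = ⊥-elim (none j 1≤j univ)

    IsUn-fin⇒universal : ∀ {k}
      → RespectsEq G U → NonEmpty G U → IsUn G U (fin k) → Universal G U k
    IsUn-fin⇒universal _    _        (un-largest _ _ univ _) = univ
    IsUn-fin⇒universal resp nonEmpty (un-none _ _)           = NonEmpty⇒Universal₁ resp nonEmpty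

corollary11 : ∀ {c ℓ p : Level} (G : AbelianGroup c ℓ) → IsFinite G
    → (A B : AbelianGroup.Carrier G → Set p)
    → RespectsEq G A → RespectsEq G B → NonEmpty G A → NonEmpty G B
    → ∀ a b s → IsUn G A a → IsUn G B b → IsUn G (Sumset G A B) s
    → (a *∞ b) ≤∞ s
corollary11 G _ A B _ _ _ _ a b ∞ _ _ _ = (a *∞ b) ≤∞∞
corollary11 G _ A B _ _ _ nonEmptyB ∞ b (fin k) (un-whole wholeA) _ unSum =
  ⊥-elim (IsUn-fin⇒¬whole G unSum (Sumset-wholeˡ G wholeA nonEmptyB))
corollary11 G _ A B _ _ nonEmptyA _ (fin m) ∞ (fin k) _ (un-whole wholeB) unSum =
  ⊥-elim (IsUn-fin⇒¬whole G unSum (Sumset-wholeʳ G nonEmptyA wholeB))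
corollary11 G _ A B respA respB nonEmptyA nonEmptyB (fin m) (fin n) (fin k) unA unB unSum =
  fin≤fin (IsUn-fin⇒maximal G unSum (m * n)
    (*-mono-≤ (IsUn-fin⇒positive G unA) (IsUn-fin⇒positive G unB))
    (Universal-* G {A = A} {B} (IsUn-fin⇒universal G respA nonEmptyA unA)
                   (IsUn-fin⇒universal G respB nonEmptyB unB)))
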